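{- For every positive integer $n$, the graph $C_3 \times K_n$ admits a $C_6$-decomposition.
   Context: $K_n$ is the complete graph on $n$ vertices, $C_k$ the cycle of length $k$. The tensor product $G \times H$ has vertex set $V(G)\times V(H)$, with $(g_1,h_1)$ adjacent to $(g_2,h_2)$ iff $g_1g_2 \in E(G)$ and $h_1h_2 \in E(H)$. A $C_k$-decomposition of a graph is a partition of its edge set into edge sets of subgraphs isomorphic to $C_k$. -}

module Defs where

open import Data.Nat using (ℕ; suc; _%_; NonZero)
open import Data.Fin using (Fin; toℕ)
open import Data.Product using (Σ; _×_; _,_; ∃!)
open import Data.Sum using (_⊎_)
open import Function.Definitions using (Injective)
open import Relation.Binary.PropositionalEquality using (_≡_; _≢_)

record Graph : Set₁ where
  field
    V   : Set
    Adj : V → V → Set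
open Graph public

CycStep : (k : ℕ) .{{_ : NonZero k}} → Fin k → Fin k → Set
CycStep k i j = toℕ j ≡ suc (toℕ i) % k

C : (k : ℕ) .{{_ : NonZero k}} → Graph
C k = record { V = Fin k ; Adj = λ i j → CycStep k i j ⊎ CycStep k j i }

K : ℕ → Graph
K n = record { V = Fin n ; Adj = λ i j → i ≢ j }

_⊗_ : Graph → Graph → Graph
G ⊗ H = record
  { V   = V G × V H
  ; Adj = λ p q → Adj G (Σ.proj₁ p) (Σ.proj₁ q) × Adj H (Σ.proj₂ p) (Σ.proj₂ q)
  }

-- A subgraph of G isomorphic to C_k: an injective map Fin k → V G sending
-- cycle edges to edges of G. Its edge set is the image of the edges of C_k.
record CycleIn (k : ℕ) .{{_ : NonZero k}} (G : Graph) : Set where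
  field
    f      : Fin k → V G
    inj    : Injective _≡_ _≡_ f
    hom    : ∀ i j → Adj (C k) i j → Adj G (f i) (f j)
open CycleIn public

EdgeOf : ∀ {k} .{{_ : NonZero k}} {G : Graph} → CycleIn k G → V G → V G → Set
EdgeOf {k} c u v = Σ (Fin k) λ i → Σ (Fin k) λ j → Adj (C k) i j × f c i ≡ u × f c j ≡ v

Decomposition : (k : ℕ) .{{_ : NonZero k}} → Graph → Set
Decomposition k G =
  Σ ℕ λ m → Σ (Fin m → CycleIn k G) λ cyc →
    ∀ u v → Adj G u v → ∃! _≡_ (λ (j : Fin m) → EdgeOf (cyc j) u v)

-- C₃ × K₂ is itself a 6-cycle: i ↦ (i mod 3, i mod 2) is an isomorphism C₆ ≅ C₃ × K₂
-- (Chinese remainder theorem). The edges of H × Kₙ split according to the unordered pair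
-- {x, y} of Kₙ-coordinates of their ends, and the edges belonging to {x, y} form a copy
-- of H × K₂. So any C_k-decomposition of H × K₂, copied onto each of the n(n-1)/2 layer
-- pairs, is a C_k-decomposition of H × Kₙ.
module Submission where

open import Defs
open import Data.Nat using (ℕ; zero; suc; _+_; _*_; _≥_; NonZero)
import Data.Nat as ℕ
import Data.Nat.Properties as ℕₚ
open import Data.Nat.DivMod using (m%n<n)
open import Data.Fin using (Fin; zero; suc; toℕ; fromℕ; fromℕ<; inject₁; opposite; _<_;
  splitAt; join; _↑ˡ_; _↑ʳ_; combine; remQuot)
open import Data.Fin.Properties using (toℕ-injective; toℕ-fromℕ<; toℕ-fromℕ; toℕ-inject₁; toℕ<n;
  inject₁-injective; fromℕ≢inject₁; ≤fromℕ; <-irrefl; <-asym; <-cmp; <⇒≢;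
  splitAt-↑ˡ; splitAt-↑ʳ; join-splitAt; remQuot-combine; combine-remQuot)
open import Data.Fin.Relation.Unary.Top using (view; ‵fromℕ; ‵inject₁)
open import Data.Product using (∃; _×_; _,_; proj₁; proj₂; uncurry; ∃!)
import Data.Product as Product
open import Data.Sum using (_⊎_; inj₁; inj₂)
import Data.Sum as Sum
open import Function using (_∘_)
open import Function.Definitions using (Injective)
open import Relation.Binary using (tri<; tri≈; tri>)
open import Relation.Binary.PropositionalEquality
open import Relation.Nullary using (contradiction)

private
  variable
    k n : ℕ
    G H : Graph

next : .{{_ : NonZero k}} → Fin k → Fin k
next {k} i = fromℕ< (m%n<n (suc (toℕ i)) k)

CycStep-next : .{{_ : NonZero k}} (i : Fin k) → CycStep k i (next i)
CycStep-next {k} i = toℕ-fromℕ< (m%n<n (suc (toℕ i)) k)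

CycStep⇒≡next : .{{_ : NonZero k}} {i j : Fin k} → CycStep k i j → j ≡ next i
CycStep⇒≡next {i = i} step = toℕ-injective (trans step (sym (CycStep-next i)))

C-Adj⇒next : .{{_ : NonZero k}} {i j : Fin k} → Adj (C k) i j → j ≡ next i ⊎ i ≡ next j
C-Adj⇒next (inj₁ step) = inj₁ (CycStep⇒≡next step)
C-Adj⇒next (inj₂ step) = inj₂ (CycStep⇒≡next step)

record _↪_ (G H : Graph) : Set where
  field
    map       : V G → V H
    injective : Injective _≡_ _≡_ map
    preserves : ∀ {u v} → Adj G u v → Adj H (map u) (map v)
open _↪_

module _ .{{_ : NonZero k}} where

  mapCycle : G ↪ H → CycleIn k G → CycleIn k H
  mapCycle φ c = record
    { f   = map φ ∘ f c
    ; inj = inj c ∘ injective φ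
    ; hom = λ i j → preserves φ ∘ hom c i j
    }

  EdgeOf-map : (φ : G ↪ H) (c : CycleIn k G) {u v : V G} →
               EdgeOf c u v → EdgeOf (mapCycle φ c) (map φ u) (map φ v)
  EdgeOf-map φ c (i , j , ij , refl , refl) = i , j , ij , refl , refl

  EdgeOf-unmap : (φ : G ↪ H) (c : CycleIn k G) {u v : V G} →
                 EdgeOf (mapCycle φ c) (map φ u) (map φ v) → EdgeOf c u v
  EdgeOf-unmap φ c (i , j , ij , fi≡u , fj≡v) =
    i , j , ij , injective φ fi≡u , injective φ fj≡v

  cycle-isomorphism⇒Decomposition : (c : CycleIn k G) (g : V G → Fin k) →
    (∀ u → f c (g u) ≡ u) → (∀ {u v} → Adj G u v → Adj (C k) (g u) (g v)) →
    Decomposition k G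
  cycle-isomorphism⇒Decomposition c g f∘g≗id g-hom =
    1 , (λ _ → c) ,
    λ u v uv → zero , (g u , g v , g-hom uv , f∘g≗id u , f∘g≗id v) , λ { {zero} _ → refl }

opposite-≢ : (s : Fin 2) → s ≢ opposite s
opposite-≢ zero       ()
opposite-≢ (suc zero) ()

≢⇒≡opposite : {s t : Fin 2} → s ≢ t → t ≡ opposite s
≢⇒≡opposite {zero}     {zero}     s≢t = contradiction refl s≢t
≢⇒≡opposite {zero}     {suc zero} _   = refl
≢⇒≡opposite {suc zero} {zero}     _   = refl
≢⇒≡opposite {suc zero} {suc zero} s≢t = contradiction refl s≢t

hexagon : Fin 6 → Fin 3 × Fin 2
hexagon zero                               = zero           , zero
hexagon (suc zero)                         = suc zero       , suc zero
hexagon (suc (suc zero))                   = suc (suc zero) , zero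
hexagon (suc (suc (suc zero)))             = zero           , suc zero
hexagon (suc (suc (suc (suc zero))))       = suc zero       , zero
hexagon (suc (suc (suc (suc (suc zero))))) = suc (suc zero) , suc zero

hexagon⁻¹ : Fin 3 × Fin 2 → Fin 6
hexagon⁻¹ (zero           , zero)     = zero
hexagon⁻¹ (suc zero       , suc zero) = suc zero
hexagon⁻¹ (suc (suc zero) , zero)     = suc (suc zero)
hexagon⁻¹ (zero           , suc zero) = suc (suc (suc zero))
hexagon⁻¹ (suc zero       , zero)     = suc (suc (suc (suc zero)))
hexagon⁻¹ (suc (suc zero) , suc zero) = suc (suc (suc (suc (suc zero))))

hexagon⁻¹∘hexagon : ∀ i → hexagon⁻¹ (hexagon i) ≡ i
hexagon⁻¹∘hexagon zero                               = refl
hexagon⁻¹∘hexagon (suc zero)                         = refl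
hexagon⁻¹∘hexagon (suc (suc zero))                   = refl
hexagon⁻¹∘hexagon (suc (suc (suc zero)))             = refl
hexagon⁻¹∘hexagon (suc (suc (suc (suc zero))))       = refl
hexagon⁻¹∘hexagon (suc (suc (suc (suc (suc zero))))) = refl

hexagon∘hexagon⁻¹ : ∀ u → hexagon (hexagon⁻¹ u) ≡ u
hexagon∘hexagon⁻¹ (zero           , zero)     = refl
hexagon∘hexagon⁻¹ (suc zero       , suc zero) = refl
hexagon∘hexagon⁻¹ (suc (suc zero) , zero)     = refl
hexagon∘hexagon⁻¹ (zero           , suc zero) = refl
hexagon∘hexagon⁻¹ (suc zero       , zero)     = refl
hexagon∘hexagon⁻¹ (suc (suc zero) , suc zero) = refl

hexagon-next : ∀ i → hexagon (next i) ≡ Product.map next opposite (hexagon i)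
hexagon-next zero                               = refl
hexagon-next (suc zero)                         = refl
hexagon-next (suc (suc zero))                   = refl
hexagon-next (suc (suc (suc zero)))             = refl
hexagon-next (suc (suc (suc (suc zero))))       = refl
hexagon-next (suc (suc (suc (suc (suc zero))))) = refl

hexagon⁻¹-next : ∀ u → hexagon⁻¹ (Product.map next opposite u) ≡ next (hexagon⁻¹ u)
hexagon⁻¹-next u = begin
  hexagon⁻¹ (Product.map next opposite u)
    ≡⟨ cong (hexagon⁻¹ ∘ Product.map next opposite) (hexagon∘hexagon⁻¹ u) ⟨
  hexagon⁻¹ (Product.map next opposite (hexagon (hexagon⁻¹ u)))
    ≡⟨ cong hexagon⁻¹ (hexagon-next (hexagon⁻¹ u)) ⟨
  hexagon⁻¹ (hexagon (next (hexagon⁻¹ u)))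
    ≡⟨ hexagon⁻¹∘hexagon (next (hexagon⁻¹ u)) ⟩
  next (hexagon⁻¹ u)
    ∎
  where open ≡-Reasoning

hexagon-step : ∀ i → Adj (C 3 ⊗ K 2) (hexagon i) (hexagon (next i))
hexagon-step i rewrite hexagon-next i =
  inj₁ (CycStep-next (proj₁ (hexagon i))) , opposite-≢ (proj₂ (hexagon i))

hexagon-hom : ∀ i j → Adj (C 6) i j → Adj (C 3 ⊗ K 2) (hexagon i) (hexagon j)
hexagon-hom i j ij with C-Adj⇒next ij
... | inj₁ refl = hexagon-step i
... | inj₂ refl = Product.map Sum.swap ≢-sym (hexagon-step j)

hexagon⁻¹-step : ∀ {a b s t} → b ≡ next a → s ≢ t →
                 CycStep 6 (hexagon⁻¹ (a , s)) (hexagon⁻¹ (b , t))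
hexagon⁻¹-step {a} {s = s} refl s≢t rewrite ≢⇒≡opposite s≢t | hexagon⁻¹-next (a , s) =
  CycStep-next (hexagon⁻¹ (a , s))

hexagon⁻¹-hom : ∀ {u v} → Adj (C 3 ⊗ K 2) u v → Adj (C 6) (hexagon⁻¹ u) (hexagon⁻¹ v)
hexagon⁻¹-hom {a , _} {b , _} (ab , s≢t) with C-Adj⇒next ab
... | inj₁ b≡next-a = inj₁ (hexagon⁻¹-step {a} b≡next-a s≢t)
... | inj₂ a≡next-b = inj₂ (hexagon⁻¹-step {b} a≡next-b (≢-sym s≢t))

hexagonCycle : CycleIn 6 (C 3 ⊗ K 2)
hexagonCycle = record
  { f   = hexagon
  ; inj = λ {i} {j} e →
      trans (sym (hexagon⁻¹∘hexagon i)) (trans (cong hexagon⁻¹ e) (hexagon⁻¹∘hexagon j))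
  ; hom = hexagon-hom
  }

C₃⊗K₂-Decomposition : Decomposition 6 (C 3 ⊗ K 2)
C₃⊗K₂-Decomposition =
  cycle-isomorphism⇒Decomposition hexagonCycle hexagon⁻¹ hexagon∘hexagon⁻¹ hexagon⁻¹-hom

triangular : ℕ → ℕ
triangular zero    = zero
triangular (suc n) = triangular n + n

pairAt  : ∀ n → Fin (triangular n) → Fin n × Fin n
pairAt⊎ : ∀ n → Fin (triangular n) ⊎ Fin n → Fin (suc n) × Fin (suc n)

pairAt zero    ()
pairAt (suc n) = pairAt⊎ n ∘ splitAt (triangular n)

pairAt⊎ n (inj₁ i) = Product.map inject₁ inject₁ (pairAt n i)
pairAt⊎ n (inj₂ x) = inject₁ x , fromℕ n

pairAt-<  : ∀ n i → proj₁ (pairAt n i) < proj₂ (pairAt n i)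
pairAt⊎-< : ∀ n i → proj₁ (pairAt⊎ n i) < proj₂ (pairAt⊎ n i)

pairAt-< (suc n) i = pairAt⊎-< n (splitAt (triangular n) i)

pairAt⊎-< n (inj₁ i) = subst₂ ℕ._<_ (sym (toℕ-inject₁ _)) (sym (toℕ-inject₁ _)) (pairAt-< n i)
pairAt⊎-< n (inj₂ x) = subst₂ ℕ._<_ (sym (toℕ-inject₁ x)) (sym (toℕ-fromℕ n)) (toℕ<n x)

pairAt-≢ : ∀ n i → proj₁ (pairAt n i) ≢ proj₂ (pairAt n i)
pairAt-≢ n i = <⇒≢ (pairAt-< n i)

splitAt-injective : ∀ m {n} → Injective _≡_ _≡_ (splitAt m {n})
splitAt-injective m {n} {i} {j} e = begin
  i                        ≡⟨ join-splitAt m n i ⟨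
  join m n (splitAt m i)   ≡⟨ cong (join m n) e ⟩
  join m n (splitAt m j)   ≡⟨ join-splitAt m n j ⟩
  j                        ∎
  where open ≡-Reasoning

pairAt-injective  : ∀ n → Injective _≡_ _≡_ (pairAt n)
pairAt⊎-injective : ∀ n → Injective _≡_ _≡_ (pairAt⊎ n)

pairAt-injective (suc n) = splitAt-injective (triangular n) ∘ pairAt⊎-injective n

pairAt⊎-injective n {inj₁ i} {inj₁ j} e = cong inj₁ (pairAt-injective n
  (cong₂ _,_ (inject₁-injective (cong proj₁ e)) (inject₁-injective (cong proj₂ e))))
pairAt⊎-injective n {inj₁ i} {inj₂ y} e = contradiction (sym (cong proj₂ e)) fromℕ≢inject₁
pairAt⊎-injective n {inj₂ x} {inj₁ j} e = contradiction (cong proj₂ e) fromℕ≢inject₁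
pairAt⊎-injective n {inj₂ x} {inj₂ y} e = cong inj₂ (inject₁-injective (cong proj₁ e))

pairAt-surjective : {x y : Fin n} → x < y → ∃ λ i → pairAt n i ≡ (x , y)
pairAt-surjective {suc n} {x} {y} x<y with view y | view x
... | ‵fromℕ       | ‵fromℕ       = contradiction x<y (<-irrefl refl)
... | ‵fromℕ       | ‵inject₁ x′  =
  triangular n ↑ʳ x′ , cong (pairAt⊎ n) (splitAt-↑ʳ (triangular n) n x′)
... | ‵inject₁ y′  | ‵fromℕ       = contradiction (≤fromℕ (inject₁ y′)) (ℕₚ.<⇒≱ x<y)
... | ‵inject₁ y′  | ‵inject₁ x′
  with i , pairAt-i ← pairAt-surjective {n} (subst₂ ℕ._<_ (toℕ-inject₁ x′) (toℕ-inject₁ y′) x<y) =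
  i ↑ˡ n ,
  trans (cong (pairAt⊎ n) (splitAt-↑ˡ (triangular n) i n)) (cong (Product.map inject₁ inject₁) pairAt-i)

SameUnordered : {A : Set} → A × A → A × A → Set
SameUnordered (p , q) (x , y) = (p ≡ x × q ≡ y) ⊎ (p ≡ y × q ≡ x)

SameUnordered-<⇒≡ : {p q p′ q′ x y : Fin n} → p < q → p′ < q′ →
  SameUnordered (p , q) (x , y) → SameUnordered (p′ , q′) (x , y) → (p , q) ≡ (p′ , q′)
SameUnordered-<⇒≡ _   _     (inj₁ (refl , refl)) (inj₁ (refl , refl)) = refl
SameUnordered-<⇒≡ _   _     (inj₂ (refl , refl)) (inj₂ (refl , refl)) = refl
SameUnordered-<⇒≡ p<q p′<q′ (inj₁ (refl , refl)) (inj₂ (refl , refl)) = contradiction p′<q′ (<-asym p<q)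
SameUnordered-<⇒≡ p<q p′<q′ (inj₂ (refl , refl)) (inj₁ (refl , refl)) = contradiction p′<q′ (<-asym p<q)

pairAt-covers : {x y : Fin n} → x ≢ y → ∃ λ i → SameUnordered (pairAt n i) (x , y)
pairAt-covers {x = x} {y} x≢y with <-cmp x y
... | tri< x<y _ _ with i , refl ← pairAt-surjective x<y = i , inj₁ (refl , refl)
... | tri≈ _ x≡y _ = contradiction x≡y x≢y
... | tri> _ _ y<x with i , refl ← pairAt-surjective y<x = i , inj₂ (refl , refl)

pairAt-unique : {i j : Fin (triangular n)} {x y : Fin n} →
  SameUnordered (pairAt n i) (x , y) → SameUnordered (pairAt n j) (x , y) → i ≡ j
pairAt-unique {n} {i} {j} i~xy j~xy =
  pairAt-injective n (SameUnordered-<⇒≡ (pairAt-< n i) (pairAt-< n j) i~xy j~xy)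

layer : Fin n → Fin n → Fin 2 → Fin n
layer p q zero       = p
layer p q (suc zero) = q

module _ {p q : Fin n} where

  layer-injective : p ≢ q → Injective _≡_ _≡_ (layer p q)
  layer-injective _   {zero}     {zero}     _ = refl
  layer-injective p≢q {zero}     {suc zero} e = contradiction e p≢q
  layer-injective p≢q {suc zero} {zero}     e = contradiction (sym e) p≢q
  layer-injective _   {suc zero} {suc zero} _ = refl

  layer-SameUnordered : {s t : Fin 2} → s ≢ t → SameUnordered (p , q) (layer p q s , layer p q t)
  layer-SameUnordered {zero}     {zero}     s≢t = contradiction refl s≢t
  layer-SameUnordered {zero}     {suc zero} _   = inj₁ (refl , refl)
  layer-SameUnordered {suc zero} {zero}     _   = inj₂ (refl , refl)
  layer-SameUnordered {suc zero} {suc zero} s≢t = contradiction refl s≢t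

  SameUnordered⇒layers : {x y : Fin n} → SameUnordered (p , q) (x , y) →
    ∃ λ s → ∃ λ t → layer p q s ≡ x × layer p q t ≡ y
  SameUnordered⇒layers (inj₁ (refl , refl)) = zero , suc zero , refl , refl
  SameUnordered⇒layers (inj₂ (refl , refl)) = suc zero , zero , refl , refl

  layerEmbedding : p ≢ q → (H ⊗ K 2) ↪ (H ⊗ K n)
  layerEmbedding p≢q = record
    { map       = Product.map₂ (layer p q)
    ; injective = λ e → cong₂ _,_ (cong proj₁ e) (layer-injective p≢q (cong proj₂ e))
    ; preserves = Product.map₂ (_∘ layer-injective p≢q)
    }

  EdgeOf-layerEmbedding : .{{_ : NonZero k}} (p≢q : p ≢ q) (c : CycleIn k (H ⊗ K 2))
    {a b : V H} {x y : Fin n} →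
    EdgeOf (mapCycle (layerEmbedding p≢q) c) (a , x) (b , y) → SameUnordered (p , q) (x , y)
  EdgeOf-layerEmbedding p≢q c (i , j , ij , refl , refl) = layer-SameUnordered (proj₂ (hom c i j ij))

⊗K₂-Decomposition⇒⊗K-Decomposition : .{{_ : NonZero k}} → ∀ n →
  Decomposition k (H ⊗ K 2) → Decomposition k (H ⊗ K n)
⊗K₂-Decomposition⇒⊗K-Decomposition {k} {H} n (m , cycle , cycle-unique) =
  triangular n * m , cycleAt , covers
  where
  copy : Fin (triangular n) → (H ⊗ K 2) ↪ (H ⊗ K n)
  copy i = layerEmbedding (pairAt-≢ n i)

  copyOf : Fin (triangular n) × Fin m → CycleIn k (H ⊗ K n)
  copyOf (i , c) = mapCycle (copy i) (cycle c)

  cycleAt : Fin (triangular n * m) → CycleIn k (H ⊗ K n)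
  cycleAt = copyOf ∘ remQuot m

  covers : ∀ u v → Adj (H ⊗ K n) u v → ∃! _≡_ (λ ℓ → EdgeOf (cycleAt ℓ) u v)
  covers (a , x) (b , y) (ab , x≢y)
    with i , i~xy ← pairAt-covers x≢y
    with s , t , refl , refl ← SameUnordered⇒layers i~xy
    with c , edge , c-unique ← cycle-unique (a , s) (b , t) (ab , x≢y ∘ cong (layer _ _)) =
    combine i c ,
    subst (λ ic → EdgeOf (copyOf ic) _ _) (sym (remQuot-combine i c)) (EdgeOf-map (copy i) (cycle c) edge) ,
    λ {ℓ} → combine-unique ℓ (remQuot m ℓ) (combine-remQuot {triangular n} m ℓ)
    where
    combine-unique : ∀ ℓ ic → uncurry combine ic ≡ ℓ →
      EdgeOf (copyOf ic) (map (copy i) (a , s)) (map (copy i) (b , t)) → combine i c ≡ ℓ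
    combine-unique ℓ (i′ , c′) refl edge′
      with refl ← pairAt-unique i~xy (EdgeOf-layerEmbedding (pairAt-≢ n i′) (cycle c′) edge′) =
      cong (combine i) (c-unique (EdgeOf-unmap (copy i) (cycle c′) edge′))

theorem4p1 : (n : ℕ) → n ≥ 1 → Decomposition 6 (C 3 ⊗ K n)
theorem4p1 n _ = ⊗K₂-Decomposition⇒⊗K-Decomposition n C₃⊗K₂-Decomposition
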